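{- Let $n$ be a positive integer and $r$ a positive divisor of $n$. For any $\chi:\mathbb{Z}_r\to\{1,-1\}$, \[\operatorname{disc}(\mathcal A_n)\le \max_{A\in\mathcal A_r}|\chi(A)|+\frac{n}{r}\cdot\max_{A_0\in\mathcal A_r^0}|\chi(A_0)|.\]
   Context: For a positive integer $N$, $\mathbb{Z}_N$ denotes the integers modulo $N$. An arithmetic progression in $\mathbb{Z}_N$ is a set $\{a+kd: 0\le k<l\}$ with $a,d\in\mathbb{Z}_N$ and $l$ an integer with $0\le l\le N/\gcd(N,d)$; $\mathcal A_N$ is the family of all arithmetic progressions in $\mathbb{Z}_N$. For $s,i\in\mathbb{Z}_N$, $C(s,i)=\{x\in\mathbb{Z}_N: x\equiv i \pmod s\}=\{i+ks: k\in\mathbb{Z}_N\}$, and $\mathcal A_N^0=\{C(s,i): s,i\in\mathbb{Z}_N\}$ is the family of congruence classes. For a function $\chi$ and a finite set $B$, $\chi(B)=\sum_{x\in B}\chi(x)$. $\operatorname{disc}(\mathcal A_N)=\min_{\chi:\mathbb{Z}_N\to\{1,-1\}}\max_{A\in\mathcal A_N}|\chi(A)|$. -}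

module Defs where

open import Data.Bool using (Bool; true; false; if_then_else_)
open import Data.Nat using (ℕ; _≡ᵇ_; NonZero)
import Data.Nat as ℕ
open import Data.Nat.DivMod using (_%_)
open import Data.Nat.GCD using (gcd)
open import Data.Fin using (Fin; toℕ)
open import Data.List using (List; map; foldr; upTo; allFin)
open import Data.Bool.ListAction using (any)
open import Data.Integer using (ℤ; _+_; 0ℤ; 1ℤ; -1ℤ; ∣_∣)
open import Data.Sum using (_⊎_)
open import Data.Product using (_×_)
open import Relation.Binary.PropositionalEquality using (_≡_)

-- Z_N is modelled by Fin N (N ≥ 1); the residue of a natural number m is m % N.
-- A subset of Z_N is a Boolean predicate Fin N → Bool.
Subset : ℕ → Set
Subset N = Fin N → Bool

IsColouring : (N : ℕ) → (Fin N → ℤ) → Set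
IsColouring N χ = ∀ x → (χ x ≡ 1ℤ) ⊎ (χ x ≡ -1ℤ)

χ[_] : ∀ {N} → (Fin N → ℤ) → Subset N → ℤ
χ[_] {N} χ B = foldr _+_ 0ℤ (map (λ x → if B x then χ x else 0ℤ) (allFin N))

AP : (N : ℕ) → .{{_ : NonZero N}} → Fin N → Fin N → ℕ → Subset N
AP N a d l x = any (λ k → toℕ x ≡ᵇ ((toℕ a ℕ.+ k ℕ.* toℕ d) % N)) (upTo l)

-- Admissible length: 0 ≤ l ≤ N / gcd(N,d), written l * gcd(N,d) ≤ N
-- (equivalent, as gcd(N,d) divides N and is positive).
AdmissibleLength : (N : ℕ) → Fin N → ℕ → Set
AdmissibleLength N d l = l ℕ.* gcd N (toℕ d) ℕ.≤ N

C : (N : ℕ) → .{{_ : NonZero N}} → Fin N → Fin N → Subset N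
C N s i x = any (λ k → toℕ x ≡ᵇ ((toℕ i ℕ.+ k ℕ.* toℕ s) % N)) (upTo N)

APMaxLE : (N : ℕ) → .{{_ : NonZero N}} → (Fin N → ℤ) → ℕ → Set
APMaxLE N χ M = ∀ (a d : Fin N) (l : ℕ) → AdmissibleLength N d l → ∣ χ[ χ ] (AP N a d l) ∣ ℕ.≤ M

CongMaxLE : (N : ℕ) → .{{_ : NonZero N}} → (Fin N → ℤ) → ℕ → Set
CongMaxLE N χ M = ∀ (s i : Fin N) → ∣ χ[ χ ] (C N s i) ∣ ℕ.≤ M

DiscLE : (N : ℕ) → .{{_ : NonZero N}} → ℕ → Set
DiscLE N M = Data.Product.Σ (Fin N → ℤ) (λ χ → IsColouring N χ × APMaxLE N χ M)

-- Colour ℤₙ by ψ(x) = χ(x mod r). An admissible progression a + kd (k < l) of ℤₙ has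
-- distinct terms, so its ψ-sum is Σ_{k<l} f(k) with f(k) = χ((a + kd) mod r). This
-- sequence has period p = r / gcd(r, d mod r); one period runs through the congruence
-- class C(d, a) of ℤᵣ and the remaining l mod p terms form an admissible progression
-- of ℤᵣ. The number of whole periods q = ⌊l/p⌋ satisfies
-- qr = qp·gcd(r, d mod r) ≤ l·gcd(n, d) ≤ n, so q ≤ n/r.
module Submission where

open import Defs
open import Data.Bool using (Bool; true; false; if_then_else_; _∨_; T)
open import Data.Bool.Properties using (∨-identityʳ; ∨-assoc; ⇔→≡; T-≡)
open import Data.Bool.ListAction using (any)
open import Data.Empty using (⊥; ⊥-elim)
open import Data.Fin using (Fin; toℕ; fromℕ<) renaming (zero to fzero; suc to fsuc)
open import Data.Fin.Properties using (toℕ-fromℕ<; toℕ-injective)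
open import Data.Nat.Solver using (module +-*-Solver)
open import Data.Integer using (ℤ; +_; 0ℤ; ∣_∣) renaming (_+_ to _⊕_; _*_ to _⊛_)
open import Data.Integer.Properties
  using (+-0-commutativeMonoid; +-identityˡ; +-identityʳ; ∣i+j∣≤∣i∣+∣j∣; ∣i*j∣≡∣i∣*∣j∣; suc-*)
  renaming (+-assoc to ⊕-assoc)
open import Data.List using (upTo; applyUpTo; foldr; tabulate; allFin)
open import Data.List.Properties using (map-cong; map-tabulate)
open import Data.List.Membership.Propositional using (find; lose)
open import Data.List.Membership.Propositional.Properties using (∈-upTo⁺; ∈-upTo⁻)
open import Data.List.Relation.Unary.Any.Properties using (any⁺; any⁻)
open import Data.Nat
  using (ℕ; zero; suc; NonZero; _≡ᵇ_; _+_; _*_; _∸_; _<_; _≤_; ≢-nonZero; ≢-nonZero⁻¹; >-nonZero)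
open import Data.Nat.Properties
  using ( ≤-refl; ≤-trans; ≤-reflexive; <-≤-trans; ≤-<-trans; <⇒≤; <⇒≱; ≡ᵇ⇒≡; *-mono-≤
        ; *-monoˡ-<; *-monoˡ-≤; *-monoʳ-≤; +-mono-≤; m*n≢0; m∸n≤m; m<n⇒0<n∸m; m+[n∸m]≡n
        ; +-cancelˡ-≡; +-assoc; +-comm; *-assoc; *-identityˡ; *-distribʳ-+; m<n⇒m<1+n; n<1+n; +-suc)
open import Data.Nat.DivMod
open import Data.Nat.Divisibility
open import Data.Nat.GCD
open import Data.Product using (∃-syntax; _×_; _,_)
open import Data.Sum using (inj₁)
open import Function using (_∘_; id; _⇔_; mk⇔)
open import Relation.Binary.PropositionalEquality

open import Algebra.Properties.CommutativeMonoid.Sum +-0-commutativeMonoid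
  using (sum; ∑-distrib-+; sum-cong-≗; sum-replicate-zero)

sumUpTo : (ℕ → ℤ) → ℕ → ℤ
sumUpTo f zero    = 0ℤ
sumUpTo f (suc l) = sumUpTo f l ⊕ f l

sumUpTo-cong : ∀ {f g} → (∀ k → f k ≡ g k) → ∀ l → sumUpTo f l ≡ sumUpTo g l
sumUpTo-cong f≗g zero    = refl
sumUpTo-cong f≗g (suc l) = cong₂ _⊕_ (sumUpTo-cong f≗g l) (f≗g l)

sumUpTo-+ : ∀ f m l → sumUpTo f (m + l) ≡ sumUpTo f m ⊕ sumUpTo (λ k → f (m + k)) l
sumUpTo-+ f m zero    rewrite Data.Nat.Properties.+-identityʳ m = sym (+-identityʳ _)
sumUpTo-+ f m (suc l) rewrite +-suc m l =
  trans (cong (_⊕ f (m + l)) (sumUpTo-+ f m l)) (⊕-assoc (sumUpTo f m) _ _)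

sumUpTo-periodic : ∀ f p → (∀ k → f (p + k) ≡ f k) → ∀ q t →
  sumUpTo f (q * p + t) ≡ + q ⊛ sumUpTo f p ⊕ sumUpTo f t
sumUpTo-periodic f p per zero    t = sym (+-identityˡ _)
sumUpTo-periodic f p per (suc q) t = begin
  sumUpTo f ((p + q * p) + t)                      ≡⟨ cong (sumUpTo f) (+-assoc p (q * p) t) ⟩
  sumUpTo f (p + (q * p + t))                      ≡⟨ sumUpTo-+ f p (q * p + t) ⟩
  S ⊕ sumUpTo (λ k → f (p + k)) (q * p + t)        ≡⟨ cong (S ⊕_) (sumUpTo-cong per (q * p + t)) ⟩
  S ⊕ sumUpTo f (q * p + t)                        ≡⟨ cong (S ⊕_) (sumUpTo-periodic f p per q t) ⟩
  S ⊕ (+ q ⊛ S ⊕ sumUpTo f t)                      ≡⟨ sym (⊕-assoc S (+ q ⊛ S) _) ⟩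
  (S ⊕ + q ⊛ S) ⊕ sumUpTo f t                      ≡⟨ cong (_⊕ sumUpTo f t) (sym (suc-* (+ q) S)) ⟩
  + suc q ⊛ S ⊕ sumUpTo f t                        ∎
  where
  open ≡-Reasoning
  S = sumUpTo f p

∣q*i+j∣≤q*∣i∣+∣j∣ : ∀ q i j → ∣ + q ⊛ i ⊕ j ∣ ≤ q * ∣ i ∣ + ∣ j ∣
∣q*i+j∣≤q*∣i∣+∣j∣ q i j =
  ≤-trans (∣i+j∣≤∣i∣+∣j∣ (+ q ⊛ i) j) (≤-reflexive (cong (_+ ∣ j ∣) (∣i*j∣≡∣i∣*∣j∣ (+ q) i)))

foldr-tabulate : ∀ {N} (g : Fin N → ℤ) → foldr _⊕_ 0ℤ (tabulate g) ≡ sum g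
foldr-tabulate {zero}  g = refl
foldr-tabulate {suc N} g = cong (g fzero ⊕_) (foldr-tabulate (g ∘ fsuc))

χ[]≡∑ : ∀ {N} (h : Fin N → ℤ) (B : Subset N) →
  χ[ h ] B ≡ sum (λ x → if B x then h x else 0ℤ)
χ[]≡∑ h B = trans (cong (foldr _⊕_ 0ℤ) (map-tabulate id g)) (foldr-tabulate g)
  where
  g = λ x → if B x then h x else 0ℤ

χ[]-cong : ∀ {N} (h : Fin N → ℤ) {B B′ : Subset N} → (∀ x → B x ≡ B′ x) → χ[ h ] B ≡ χ[ h ] B′
χ[]-cong {N} h B≗B′ =
  cong (foldr _⊕_ 0ℤ) (map-cong (λ x → cong (if_then h x else 0ℤ) (B≗B′ x)) (allFin N))

sum-if-≡ᵇ : ∀ {N} (h : Fin N → ℤ) (y : Fin N) →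
  sum (λ x → if toℕ x ≡ᵇ toℕ y then h x else 0ℤ) ≡ h y
sum-if-≡ᵇ {suc N} h fzero    = trans (cong (h fzero ⊕_) (sum-replicate-zero N)) (+-identityʳ _)
sum-if-≡ᵇ {suc N} h (fsuc y) = trans (+-identityˡ _) (sum-if-≡ᵇ (h ∘ fsuc) y)

any-applyUpTo-suc : ∀ (p : ℕ → Bool) f l →
  any p (applyUpTo f (suc l)) ≡ any p (applyUpTo f l) ∨ p (f l)
any-applyUpTo-suc p f zero    = ∨-identityʳ (p (f 0))
any-applyUpTo-suc p f (suc l) =
  trans (cong (p (f 0) ∨_) (any-applyUpTo-suc p (f ∘ suc) l)) (sym (∨-assoc (p (f 0)) _ _))

T-any-upTo⇔ : ∀ (p : ℕ → Bool) l → T (any p (upTo l)) ⇔ (∃[ k ] k < l × T (p k))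
T-any-upTo⇔ p l = mk⇔ to (λ (k , k<l , pk) → any⁺ p (lose (∈-upTo⁺ k<l) pk))
  where
  to : T (any p (upTo l)) → ∃[ k ] k < l × T (p k)
  to t with k , k∈ , pk ← find (any⁻ p (upTo l) t) = k , ∈-upTo⁻ k∈ , pk

if-∨-disjoint : ∀ a b (v : ℤ) → (T a → T b → ⊥) →
  (if a ∨ b then v else 0ℤ) ≡ (if a then v else 0ℤ) ⊕ (if b then v else 0ℤ)
if-∨-disjoint true  true  v disj = ⊥-elim (disj _ _)
if-∨-disjoint true  false v disj = sym (+-identityʳ v)
if-∨-disjoint false true  v disj = sym (+-identityˡ v)
if-∨-disjoint false false v disj = refl

sum-indicator-upTo : ∀ {N} (h : Fin N → ℤ) (val : ℕ → ℕ) (val<N : ∀ k → val k < N) l →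
  (∀ {j k} → j < k → k < l → val j ≢ val k) →
  sum (λ x → if any (λ k → toℕ x ≡ᵇ val k) (upTo l) then h x else 0ℤ)
    ≡ sumUpTo (λ k → h (fromℕ< (val<N k))) l
sum-indicator-upTo {N} h val val<N zero    distinct = sum-replicate-zero N
sum-indicator-upTo {N} h val val<N (suc l) distinct = begin
  sum (λ x → if any (λ k → toℕ x ≡ᵇ val k) (upTo (suc l)) then h x else 0ℤ)
    ≡⟨ sum-cong-≗ (λ x → cong (if_then h x else 0ℤ) (any-applyUpTo-suc _ id l)) ⟩
  sum (λ x → if inFirst x ∨ hitsLast x then h x else 0ℤ)
    ≡⟨ sum-cong-≗ (λ x → if-∨-disjoint (inFirst x) (hitsLast x) (h x) (disjoint x)) ⟩
  sum (λ x → (if inFirst x then h x else 0ℤ) ⊕ (if hitsLast x then h x else 0ℤ))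
    ≡⟨ ∑-distrib-+ (λ x → if inFirst x then h x else 0ℤ) (λ x → if hitsLast x then h x else 0ℤ) ⟩
  sum (λ x → if inFirst x then h x else 0ℤ) ⊕ sum (λ x → if hitsLast x then h x else 0ℤ)
    ≡⟨ cong₂ _⊕_ (sum-indicator-upTo h val val<N l (λ j<k k<l → distinct j<k (m<n⇒m<1+n k<l)))
                 last-term ⟩
  sumUpTo (λ k → h (fromℕ< (val<N k))) l ⊕ h (fromℕ< (val<N l)) ∎
  where
  open ≡-Reasoning
  inFirst hitsLast : Fin N → Bool
  inFirst x  = any (λ k → toℕ x ≡ᵇ val k) (upTo l)
  hitsLast x = toℕ x ≡ᵇ val l
  last-term : sum (λ x → if hitsLast x then h x else 0ℤ) ≡ h (fromℕ< (val<N l))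
  last-term =
    trans (sum-cong-≗ λ x → cong (λ m → if toℕ x ≡ᵇ m then h x else 0ℤ) (sym (toℕ-fromℕ< (val<N l))))
          (sum-if-≡ᵇ h (fromℕ< (val<N l)))
  disjoint : ∀ x → T (inFirst x) → T (hitsLast x) → ⊥
  disjoint x t-first t-last with k , k<l , t-k ← Function.Equivalence.to (T-any-upTo⇔ _ l) t-first =
    distinct k<l (n<1+n l) (trans (sym (≡ᵇ⇒≡ (toℕ x) _ t-k)) (≡ᵇ⇒≡ (toℕ x) _ t-last))

any-upTo-periodic : ∀ (P : ℕ → Bool) p .{{_ : NonZero p}} {m} → p ≤ m → (∀ k → P k ≡ P (k % p)) →
  any P (upTo m) ≡ any P (upTo p)
any-upTo-periodic P p {m} p≤m per =
  ⇔→≡ (mk⇔ (to T-≡ ∘ shrink ∘ from T-≡) (to T-≡ ∘ grow ∘ from T-≡))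
  where
  open Function.Equivalence
  shrink : T (any P (upTo m)) → T (any P (upTo p))
  shrink t with k , _ , Pk ← to (T-any-upTo⇔ P m) t =
    from (T-any-upTo⇔ P p) (k % p , m%n<n k p , subst T (per k) Pk)
  grow : T (any P (upTo p)) → T (any P (upTo m))
  grow t with k , k<p , Pk ← to (T-any-upTo⇔ P p) t =
    from (T-any-upTo⇔ P m) (k , <-≤-trans k<p p≤m , Pk)

residue : ∀ N .{{_ : NonZero N}} → ℕ → Fin N
residue N m = fromℕ< (m%n<n m N)

residue-cong : ∀ N .{{_ : NonZero N}} {m m′} → m % N ≡ m′ % N → residue N m ≡ residue N m′
residue-cong N eq = toℕ-injective (trans (toℕ-fromℕ< _) (trans eq (sym (toℕ-fromℕ< _))))

apTerm : ∀ N .{{_ : NonZero N}} → Fin N → Fin N → ℕ → Fin N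
apTerm N a d k = residue N (toℕ a + k * toℕ d)

gcd-nonZero : ∀ m n .{{_ : NonZero m}} → NonZero (gcd m n)
gcd-nonZero m n = ≢-nonZero (gcd[m,n]≢0 m n (inj₁ (≢-nonZero⁻¹ m)))

m%n≡[m+o]%n⇒n∣o : ∀ m o n .{{_ : NonZero n}} → m % n ≡ (m + o) % n → n ∣ o
m%n≡[m+o]%n⇒n∣o m o n eq = ∣m+n∣m⇒∣n (divides ((m + o) / n) quotients) (n∣m*n (m / n))
  where
  open ≡-Reasoning
  quotients : (m / n) * n + o ≡ ((m + o) / n) * n
  quotients = +-cancelˡ-≡ (m % n) _ _ (begin
    m % n + ((m / n) * n + o)      ≡⟨ sym (+-assoc (m % n) _ o) ⟩
    (m % n + (m / n) * n) + o      ≡⟨ cong (_+ o) (sym (m≡m%n+[m/n]*n m n)) ⟩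
    m + o                          ≡⟨ m≡m%n+[m/n]*n (m + o) n ⟩
    (m + o) % n + ((m + o) / n) * n ≡⟨ cong (_+ ((m + o) / n) * n) (sym eq) ⟩
    m % n + ((m + o) / n) * n      ∎)

-- Equal terms j < k give N ∣ (k − j)·D, hence N ∣ (k − j)·gcd(N, D),
-- contradicting (k − j)·gcd(N, D) < l·gcd(N, D) ≤ N.
ap-terms-distinct : ∀ N .{{_ : NonZero N}} A D {l} → l * gcd N D ≤ N →
  ∀ {j k} → j < k → k < l → (A + j * D) % N ≢ (A + k * D) % N
ap-terms-distinct N A D {l} adm {j} {k} j<k k<l eq = <⇒≱ (<-≤-trans ig<lg adm) (∣⇒≤ N∣ig)
  where
  i = k ∸ j
  g = gcd N D
  instance
    g-nonZero : NonZero g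
    g-nonZero = gcd-nonZero N D
    i-nonZero : NonZero i
    i-nonZero = >-nonZero (m<n⇒0<n∸m j<k)
    ig-nonZero : NonZero (i * g)
    ig-nonZero = m*n≢0 i g
  k-as-j+i : A + k * D ≡ (A + j * D) + i * D
  k-as-j+i = begin
    A + k * D             ≡⟨ cong (λ z → A + z * D) (sym (m+[n∸m]≡n (<⇒≤ j<k))) ⟩
    A + (j + i) * D       ≡⟨ cong (λ z → A + z) (*-distribʳ-+ D j i) ⟩
    A + (j * D + i * D)   ≡⟨ sym (+-assoc A _ _) ⟩
    (A + j * D) + i * D   ∎
    where open ≡-Reasoning
  N∣ig : N ∣ i * g
  N∣ig = subst (N ∣_) (sym (c*gcd[m,n]≡gcd[cm,cn] i N D))
           (gcd-greatest (n∣m*n i) (m%n≡[m+o]%n⇒n∣o _ (i * D) N (trans eq (cong (_% N) k-as-j+i))))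
  ig<lg : i * g < l * g
  ig<lg = *-monoˡ-< g (≤-<-trans (m∸n≤m k j) k<l)

χ[]-AP : ∀ N .{{_ : NonZero N}} (h : Fin N → ℤ) a d l → AdmissibleLength N d l →
  χ[ h ] (AP N a d l) ≡ sumUpTo (h ∘ apTerm N a d) l
χ[]-AP N h a d l adm =
  trans (χ[]≡∑ h (AP N a d l))
        (sum-indicator-upTo h _ (λ k → m%n<n _ N) l (ap-terms-distinct N (toℕ a) (toℕ d) adm))

ap%-periodic : ∀ N .{{_ : NonZero N}} A D p → N ∣ p * D →
  ∀ j k → (A + (j * p + k) * D) % N ≡ (A + k * D) % N
ap%-periodic N A D p N∣pD j k = begin
  (A + (j * p + k) * D) % N         ≡⟨ cong (_% N) (solve 5 (λ A D p j k →
                                         A :+ (j :* p :+ k) :* D := (A :+ k :* D) :+ j :* (p :* D))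
                                         refl A D p j k) ⟩
  ((A + k * D) + j * (p * D)) % N   ≡⟨ %-remove-+ʳ (A + k * D) (∣-trans N∣pD (n∣m*n j)) ⟩
  (A + k * D) % N                   ∎
  where
  open ≡-Reasoning
  open +-*-Solver

module _ (N : ℕ) .{{_ : NonZero N}} (d : Fin N) where

  private instance
    gcd-d-nonZero : NonZero (gcd N (toℕ d))
    gcd-d-nonZero = gcd-nonZero N (toℕ d)

  period : ℕ
  period = N / gcd N (toℕ d)

  period-nonZero : NonZero period
  period-nonZero = ≢-nonZero (m/gcd[m,n]≢0 N (toℕ d))

  period*gcd≡N : period * gcd N (toℕ d) ≡ N
  period*gcd≡N = m/n*n≡m (gcd[m,n]∣m N (toℕ d))

  period≤N : period ≤ N
  period≤N = m/n≤m N (gcd N (toℕ d))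

  N∣period*d : N ∣ period * toℕ d
  N∣period*d = subst (_∣ period * toℕ d) period*gcd≡N (*-monoʳ-∣ period (gcd[m,n]∣n N (toℕ d)))

  apTerm-periodic : ∀ a k → apTerm N a d (period + k) ≡ apTerm N a d k
  apTerm-periodic a k = residue-cong N (begin
    (toℕ a + (period + k) * toℕ d) % N
      ≡⟨ cong (λ z → (toℕ a + (z + k) * toℕ d) % N) (sym (*-identityˡ period)) ⟩
    (toℕ a + (1 * period + k) * toℕ d) % N
      ≡⟨ ap%-periodic N (toℕ a) (toℕ d) period N∣period*d 1 k ⟩
    (toℕ a + k * toℕ d) % N                ∎)
    where open ≡-Reasoning

  C≡AP-period : ∀ a x → C N d a x ≡ AP N a d period x
  C≡AP-period a x = any-upTo-periodic _ period {{period-nonZero}} period≤N λ k →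
    cong (toℕ x ≡ᵇ_) (begin
      (toℕ a + k * toℕ d) % N
        ≡⟨ cong (λ z → (toℕ a + z * toℕ d) % N) (k≡q*p+r k) ⟩
      (toℕ a + (k / period * period + k % period) * toℕ d) % N
        ≡⟨ ap%-periodic N (toℕ a) (toℕ d) period N∣period*d (k / period) (k % period) ⟩
      (toℕ a + k % period * toℕ d) % N             ∎)
    where
    open ≡-Reasoning
    instance _ = period-nonZero
    k≡q*p+r : ∀ k → k ≡ k / period * period + k % period
    k≡q*p+r k = trans (m≡m%n+[m/n]*n k period) (+-comm (k % period) _)

  ≤period⇒admissible : ∀ {t} → t ≤ period → AdmissibleLength N d t
  ≤period⇒admissible t≤p = ≤-trans (*-monoˡ-≤ (gcd N (toℕ d)) t≤p) (≤-reflexive period*gcd≡N)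

  %period-admissible : ∀ l → AdmissibleLength N d ((l % period) {{period-nonZero}})
  %period-admissible l = ≤period⇒admissible (<⇒≤ (m%n<n l period {{period-nonZero}}))

[m+k*o]%n≡[m%n+k*[o%n]]%n : ∀ m k o n .{{_ : NonZero n}} →
  (m + k * o) % n ≡ (m % n + k * (o % n)) % n
[m+k*o]%n≡[m%n+k*[o%n]]%n m k o n = begin
  (m + k * o) % n                      ≡⟨ %-distribˡ-+ m (k * o) n ⟩
  (m % n + (k * o) % n) % n            ≡⟨ cong₂ (λ u v → (u + v) % n) (sym (m%n%n≡m%n m n)) k*o≡k*[o%n] ⟩
  (m % n % n + (k * (o % n)) % n) % n  ≡⟨ sym (%-distribˡ-+ (m % n) (k * (o % n)) n) ⟩
  (m % n + k * (o % n)) % n            ∎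
  where
  open ≡-Reasoning
  k*o≡k*[o%n] : (k * o) % n ≡ (k * (o % n)) % n
  k*o≡k*[o%n] = begin
    (k * o) % n                 ≡⟨ %-distribˡ-* k o n ⟩
    (k % n * (o % n)) % n       ≡⟨ cong (λ v → (k % n * v) % n) (sym (m%n%n≡m%n o n)) ⟩
    (k % n * (o % n % n)) % n   ≡⟨ sym (%-distribˡ-* k (o % n) n) ⟩
    (k * (o % n)) % n           ∎

reduce : ∀ {n} r .{{_ : NonZero r}} → Fin n → Fin r
reduce r x = residue r (toℕ x)

module _ {n r : ℕ} .{{_ : NonZero n}} .{{_ : NonZero r}} (r∣n : r ∣ n) where

  reduce-apTerm : ∀ a d k → reduce r (apTerm n a d k) ≡ apTerm r (reduce r a) (reduce r d) k
  reduce-apTerm a d k = residue-cong r (begin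
    toℕ (apTerm n a d k) % r                        ≡⟨ cong (_% r) (toℕ-fromℕ< _) ⟩
    (toℕ a + k * toℕ d) % n % r                     ≡⟨ m∣n⇒o%n%m≡o%m r n _ r∣n ⟩
    (toℕ a + k * toℕ d) % r                         ≡⟨ [m+k*o]%n≡[m%n+k*[o%n]]%n (toℕ a) k (toℕ d) r ⟩
    (toℕ a % r + k * (toℕ d % r)) % r
      ≡⟨ cong₂ (λ u v → (u + k * v) % r) (sym (toℕ-fromℕ< _)) (sym (toℕ-fromℕ< _)) ⟩
    (toℕ (reduce r a) + k * toℕ (reduce r d)) % r   ∎)
    where open ≡-Reasoning

  gcd-reduce∣gcd : ∀ (d : Fin n) → gcd r (toℕ (reduce r d)) ∣ gcd n (toℕ d)
  gcd-reduce∣gcd d = gcd-greatest (∣-trans g∣r r∣n) (∣n∣m%n⇒∣m g∣r g∣d%r)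
    where
    g = gcd r (toℕ (reduce r d))
    g∣r : g ∣ r
    g∣r = gcd[m,n]∣m r (toℕ (reduce r d))
    g∣d%r : g ∣ toℕ d % r
    g∣d%r = subst (g ∣_) (toℕ-fromℕ< _) (gcd[m,n]∣n r _)

  module _ (d : Fin n) where

    private instance
      period-reduce-nonZero : NonZero (period r (reduce r d))
      period-reduce-nonZero = period-nonZero r (reduce r d)

    whole-periods≤n/r : ∀ l → AdmissibleLength n d l → l / period r (reduce r d) ≤ n / r
    whole-periods≤n/r l adm = subst (_≤ n / r) (m*n/n≡m q r) (/-monoˡ-≤ r (begin
      q * r                  ≡⟨ cong (q *_) (sym (period*gcd≡N r d′)) ⟩
      q * (p * g₀)           ≡⟨ sym (*-assoc q p g₀) ⟩
      q * p * g₀             ≤⟨ *-monoˡ-≤ g₀ (m/n*n≤m l p) ⟩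
      l * g₀                 ≤⟨ *-monoʳ-≤ l (∣⇒≤ {{gcd-nonZero n (toℕ d)}} (gcd-reduce∣gcd d)) ⟩
      l * gcd n (toℕ d)      ≤⟨ adm ⟩
      n                      ∎))
      where
      open Data.Nat.Properties.≤-Reasoning
      d′ = reduce r d
      p = period r d′
      q = l / p
      g₀ = gcd r (toℕ d′)

    χ[]-lift-AP : ∀ (χ : Fin r → ℤ) a l → AdmissibleLength n d l →
      let a′ = reduce r a; d′ = reduce r d; p = period r d′ in
      χ[ χ ∘ reduce r ] (AP n a d l) ≡ + (l / p) ⊛ χ[ χ ] (C r d′ a′) ⊕ χ[ χ ] (AP r a′ d′ (l % p))
    χ[]-lift-AP χ a l adm = begin
      χ[ χ ∘ reduce r ] (AP n a d l)            ≡⟨ χ[]-AP n (χ ∘ reduce r) a d l adm ⟩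
      sumUpTo (χ ∘ reduce r ∘ apTerm n a d) l   ≡⟨ sumUpTo-cong (cong χ ∘ reduce-apTerm a d) l ⟩
      sumUpTo f l                               ≡⟨ cong (sumUpTo f) l≡q*p+t ⟩
      sumUpTo f (q * p + t)
        ≡⟨ sumUpTo-periodic f p (cong χ ∘ apTerm-periodic r d′ a′) q t ⟩
      + q ⊛ sumUpTo f p ⊕ sumUpTo f t
        ≡⟨ cong₂ (λ u v → + q ⊛ u ⊕ v) one-period remainder ⟩
      + q ⊛ χ[ χ ] (C r d′ a′) ⊕ χ[ χ ] (AP r a′ d′ t) ∎
      where
      open ≡-Reasoning
      a′ = reduce r a
      d′ = reduce r d
      p = period r d′
      q = l / p
      t = l % p
      f = χ ∘ apTerm r a′ d′
      l≡q*p+t : l ≡ q * p + t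
      l≡q*p+t = trans (m≡m%n+[m/n]*n l p) (+-comm t _)
      one-period : sumUpTo f p ≡ χ[ χ ] (C r d′ a′)
      one-period = sym (trans (χ[]-cong χ (C≡AP-period r d′ a′))
                              (χ[]-AP r χ a′ d′ p (≤period⇒admissible r d′ ≤-refl)))
      remainder : sumUpTo f t ≡ χ[ χ ] (AP r a′ d′ t)
      remainder = sym (χ[]-AP r χ a′ d′ t (%period-admissible r d′ l))

lemma3p2 : (n r : ℕ) → .{{_ : NonZero n}} → .{{_ : NonZero r}} → r ∣ n →
    (χ : Fin r → ℤ) → IsColouring r χ →
    (M₁ M₀ : ℕ) → APMaxLE r χ M₁ → CongMaxLE r χ M₀ →
    DiscLE n (M₁ + (n / r) * M₀)
lemma3p2 n r r∣n χ χ-colouring M₁ M₀ χ-AP≤ χ-C≤ = χ ∘ reduce r , χ-colouring ∘ reduce r , bound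
  where
  bound : APMaxLE n (χ ∘ reduce r) (M₁ + n / r * M₀)
  bound a d l adm = begin
    ∣ χ[ χ ∘ reduce r ] (AP n a d l) ∣               ≡⟨ cong ∣_∣ (χ[]-lift-AP r∣n d χ a l adm) ⟩
    ∣ + q ⊛ χ[ χ ] (C r d′ a′) ⊕ χ[ χ ] (AP r a′ d′ t) ∣ ≤⟨ ∣q*i+j∣≤q*∣i∣+∣j∣ q _ _ ⟩
    q * ∣ χ[ χ ] (C r d′ a′) ∣ + ∣ χ[ χ ] (AP r a′ d′ t) ∣
      ≤⟨ +-mono-≤ (*-mono-≤ (whole-periods≤n/r r∣n d l adm) (χ-C≤ d′ a′))
                  (χ-AP≤ a′ d′ t (%period-admissible r d′ l)) ⟩
    n / r * M₀ + M₁                                  ≡⟨ +-comm _ M₁ ⟩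
    M₁ + n / r * M₀                                  ∎
    where
    open Data.Nat.Properties.≤-Reasoning
    a′ = reduce r a
    d′ = reduce r d
    p = period r d′
    instance _ = period-nonZero r d′
    q = l / p
    t = l % p
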